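{- Let $G$ be a connected $k$-regular graph with $k\geq 1$. Then $k\leq rd(G)\leq k+1$.
   Context: All graphs are simple, finite and undirected. For an edge-coloring of $G$ (adjacent edges may receive the same color), an edge-cut $R$ is a rainbow cut if no two edges of $R$ have the same color; it is a $u$-$v$ rainbow cut if $u$ and $v$ lie in different components of $G-R$. $G$ is rainbow disconnected if every two vertices $u,v$ have a $u$-$v$ rainbow cut. For a nontrivial connected graph $G$, $rd(G)$ is the smallest number of colors in an edge-coloring making $G$ rainbow disconnected. -}

module Defs where

open import Data.Nat using (ℕ; zero; suc)
open import Data.Bool using (Bool; true; false; if_then_else_; _∧_; not)
open import Data.Fin using (Fin)
open import Data.List using (List; map; allFin)
open import Data.Nat.ListAction using (sum)
open import Data.Product using (Σ; _×_; _,_; ∃)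
open import Data.Sum using (_⊎_)
open import Relation.Binary.PropositionalEquality using (_≡_; _≢_)
open import Relation.Nullary using (¬_)

record Graph (n : ℕ) : Set where
  field
    adj   : Fin n → Fin n → Bool
    sym   : ∀ u v → adj u v ≡ adj v u
    irrefl : ∀ v → adj v v ≡ false
open Graph public

data Reach {n : ℕ} (E : Fin n → Fin n → Bool) : Fin n → Fin n → Set where
  here : ∀ {u} → Reach E u u
  step : ∀ {u w v} → E u w ≡ true → Reach E w v → Reach E u v

Connected : ∀ {n} → Graph n → Set
Connected G = ∀ u v → Reach (adj G) u v

degree : ∀ {n} → Graph n → Fin n → ℕ
degree G v = sum (map (λ u → if adj G v u then 1 else 0) (allFin _))

Regular : ∀ {n} → ℕ → Graph n → Set
Regular k G = ∀ v → degree G v ≡ k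

-- An edge-coloring of G with (at most) m colors: a symmetric assignment of a
-- color in Fin m to every pair; only its values on edges matter.
record EdgeColoring {n : ℕ} (G : Graph n) (m : ℕ) : Set where
  field
    col    : Fin n → Fin n → Fin m
    colSym : ∀ u v → col u v ≡ col v u
open EdgeColoring public

record EdgeSet {n : ℕ} (G : Graph n) : Set where
  field
    mem    : Fin n → Fin n → Bool
    memSym : ∀ u v → mem u v ≡ mem v u
    memSub : ∀ u v → mem u v ≡ true → adj G u v ≡ true
open EdgeSet public

removeEdges : ∀ {n} (G : Graph n) → EdgeSet G → Fin n → Fin n → Bool
removeEdges G R u v = adj G u v ∧ not (mem R u v)

Rainbow : ∀ {n m} {G : Graph n} → EdgeColoring G m → EdgeSet G → Set
Rainbow c R = ∀ a b x y → mem R a b ≡ true → mem R x y ≡ true →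
  col c a b ≡ col c x y → (a ≡ x × b ≡ y) ⊎ (a ≡ y × b ≡ x)

RainbowCut : ∀ {n m} {G : Graph n} → EdgeColoring G m → EdgeSet G → Fin n → Fin n → Set
RainbowCut {G = G} c R u v = Rainbow c R × ¬ Reach (removeEdges G R) u v

RainbowDisconnected : ∀ {n m} {G : Graph n} → EdgeColoring G m → Set
RainbowDisconnected {n} {G = G} c =
  ∀ (u v : Fin n) → u ≢ v → Σ (EdgeSet G) λ R → RainbowCut c R u v

RDColorable : ∀ {n} → Graph n → ℕ → Set
RDColorable G m = Σ (EdgeColoring G m) RainbowDisconnected

module Submission where

-- Upper bound: by Vizing's theorem G has a proper edge coloring with k + 1 colors, and in a
-- proper coloring the edges at a vertex u form a rainbow cut separating u from all other vertices.
-- Lower bound: the last two vertices s, t of a maximum adjacency ordering form a pendant pair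
-- (Nagamochi–Ibaraki, Stoer–Wagner): every cut separating s from t has at least deg t = k edges,
-- so a rainbow s-t cut already uses k colors.

open import Defs hiding (sym)
open import Algebra.Properties.CommutativeMonoid.Sum as Sum using ()
open import Data.Bool using (Bool; true; false; if_then_else_; _∧_; _∨_; not)
open import Data.Bool.Properties using (∧-zeroʳ; ∧-identityʳ; ∨-identityʳ; ∨-comm) renaming (_≟_ to _≟B_)
open import Data.Empty using (⊥; ⊥-elim)
open import Data.Fin using (Fin; zero; suc; toℕ; fromℕ<)
open import Data.Fin.Properties using (any?; pigeonhole; toℕ<n; toℕ-fromℕ<; suc-injective) renaming (_≟_ to _≟F_)
open import Data.List using (List; []; _∷_; allFin; tabulate; cartesianProduct)
open import Data.List.Membership.Propositional using (_∈_)
open import Data.List.Membership.Propositional.Properties using (∈-cartesianProduct⁺; ∈-allFin)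
open import Data.List.Properties using (map-tabulate)
open import Data.List.Relation.Unary.Any using (here; there)
import Data.Nat.ListAction as List
open import Data.Nat using (ℕ; zero; suc; pred; _+_; _≤_; _<_; z≤n; s≤s; s≤s⁻¹; _≤?_)
open import Data.Nat.Properties
  using (≤-refl; ≤-reflexive; ≤-trans; ≤-antisym; <⇒≤; ≤∧≢⇒<; <-trans; <-irrefl; <-cmp; n≤1+n; n<1+n;
         m≤m+n; m≤n+m; ≤-total; +-comm; +-assoc; +-identityʳ; +-mono-≤; +-monoˡ-≤; +-monoʳ-≤; +-cancelʳ-≤;
         +-0-commutativeMonoid; anyUpTo?; module ≤-Reasoning)
  renaming (_≟_ to _≟N_; suc-injective to ℕ-suc-injective)
open import Data.Product using (Σ; _×_; _,_; ∃; proj₁; proj₂; map₂)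
open import Data.Sum using (_⊎_; inj₁; inj₂; swap)
open import Relation.Binary using (tri<; tri≈; tri>)
open import Relation.Binary.Construct.Closure.ReflexiveTransitive using (Star; ε; _◅_; _◅◅_)
import Relation.Binary.Construct.Closure.ReflexiveTransitive as Star
open import Relation.Binary.PropositionalEquality
open import Relation.Nullary using (¬_; Dec; yes; no; does)
open import Relation.Nullary.Decidable using (_×-dec_; _⊎-dec_; dec-true; dec-false; ¬?; decidable-stable)

open Sum +-0-commutativeMonoid using (sum; sum-cong-≗; ∑-comm)

true≢false : ∀ {b} → b ≡ true → b ≡ false → ⊥
true≢false refl ()

∧-true⁻ : ∀ {a b} → a ∧ b ≡ true → a ≡ true × b ≡ true
∧-true⁻ {true} {true} _ = refl , refl

∧-true⁺ : ∀ {a b} → a ≡ true → b ≡ true → a ∧ b ≡ true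
∧-true⁺ refl refl = refl

∨-true⁻ : ∀ {a b} → a ∨ b ≡ true → a ≡ true ⊎ b ≡ true
∨-true⁻ {true} _ = inj₁ refl
∨-true⁻ {false} e = inj₂ e

∨-trueˡ : ∀ {a} b → a ≡ true → a ∨ b ≡ true
∨-trueˡ b refl = refl

∨-trueʳ : ∀ a {b} → b ≡ true → a ∨ b ≡ true
∨-trueʳ true _ = refl
∨-trueʳ false e = e

not-true⁻ : ∀ {a} → not a ≡ true → a ≡ false
not-true⁻ {false} _ = refl

not-true⁺ : ∀ {a} → a ≡ false → not a ≡ true
not-true⁺ refl = refl

¬true⇒false : ∀ {b} → ¬ b ≡ true → b ≡ false
¬true⇒false {true} ¬t = ⊥-elim (¬t refl)
¬true⇒false {false} _ = refl

¬false⇒true : ∀ {b} → ¬ b ≡ false → b ≡ true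
¬false⇒true {true} _ = refl
¬false⇒true {false} ¬f = ⊥-elim (¬f refl)

does-true⁻ : ∀ {A : Set} (d : Dec A) → does d ≡ true → A
does-true⁻ (yes a) _ = a

-- Finite sums and double counting

⟦_⟧ : Bool → ℕ
⟦ b ⟧ = if b then 1 else 0

⟦⟧≤1 : ∀ b → ⟦ b ⟧ ≤ 1
⟦⟧≤1 true = ≤-refl
⟦⟧≤1 false = z≤n

⟦⟧-mono : ∀ {a b} → (a ≡ true → b ≡ true) → ⟦ a ⟧ ≤ ⟦ b ⟧
⟦⟧-mono {false} _ = z≤n
⟦⟧-mono {true} a⇒b rewrite a⇒b refl = ≤-refl

⟦⟧-positive⁻ : ∀ {b} → 1 ≤ ⟦ b ⟧ → b ≡ true
⟦⟧-positive⁻ {true} _ = refl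

sum-mono-≤ : ∀ {n} {f g : Fin n → ℕ} → (∀ x → f x ≤ g x) → sum f ≤ sum g
sum-mono-≤ {zero} _ = z≤n
sum-mono-≤ {suc n} f≤g = +-mono-≤ (f≤g zero) (sum-mono-≤ (λ x → f≤g (suc x)))

term≤sum : ∀ {n} (f : Fin n → ℕ) a → f a ≤ sum f
term≤sum f zero = m≤m+n _ _
term≤sum f (suc a) = ≤-trans (term≤sum (λ x → f (suc x)) a) (m≤n+m _ _)

sum-const-1 : ∀ n → sum {n} (λ _ → 1) ≡ n
sum-const-1 zero = refl
sum-const-1 (suc n) = cong suc (sum-const-1 n)

sum-zero : ∀ {n} (f : Fin n → ℕ) → (∀ x → f x ≡ 0) → sum f ≡ 0
sum-zero {zero} _ _ = refl
sum-zero {suc n} f f≡0 rewrite f≡0 zero = sum-zero (λ x → f (suc x)) (λ x → f≡0 (suc x))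

sum-positive⁻ : ∀ {n} (f : Fin n → ℕ) → 1 ≤ sum f → ∃ λ x → 1 ≤ f x
sum-positive⁻ {suc n} f pos with f zero in eq
... | suc _ = zero , subst (1 ≤_) (sym eq) (s≤s z≤n)
... | zero with sum-positive⁻ (λ x → f (suc x)) pos
... | x , p = suc x , p

sum-mono-≤-except : ∀ {n} (f g : Fin n → ℕ) a → (∀ x → x ≢ a → f x ≤ g x) → sum f + g a ≤ sum g + f a
sum-mono-≤-except {suc n} f g zero f≤g = begin
  f zero + sum (λ x → f (suc x)) + g zero   ≡⟨ +-assoc (f zero) _ _ ⟩
  f zero + (sum (λ x → f (suc x)) + g zero) ≡⟨ cong (f zero +_) (+-comm _ (g zero)) ⟩
  f zero + (g zero + sum (λ x → f (suc x))) ≤⟨ +-monoʳ-≤ (f zero) (+-monoʳ-≤ (g zero) (sum-mono-≤ (λ x → f≤g (suc x) λ ()))) ⟩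
  f zero + (g zero + sum (λ x → g (suc x))) ≡⟨ +-comm (f zero) _ ⟩
  g zero + sum (λ x → g (suc x)) + f zero   ∎
  where open ≤-Reasoning
sum-mono-≤-except {suc n} f g (suc a) f≤g = begin
  f zero + sum (λ x → f (suc x)) + g (suc a)   ≡⟨ +-assoc (f zero) _ _ ⟩
  f zero + (sum (λ x → f (suc x)) + g (suc a)) ≤⟨ +-mono-≤ (f≤g zero λ ()) rest ⟩
  g zero + (sum (λ x → g (suc x)) + f (suc a)) ≡⟨ sym (+-assoc (g zero) _ _) ⟩
  g zero + sum (λ x → g (suc x)) + f (suc a)   ∎
  where
  open ≤-Reasoning
  rest = sum-mono-≤-except (λ x → f (suc x)) (λ x → g (suc x)) a (λ x x≢a → f≤g (suc x) (λ e → x≢a (suc-injective e)))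

sum-strictly-mono : ∀ {n} (f g : Fin n → ℕ) a → (∀ x → f x ≤ g x) → f a < g a → sum f < sum g
sum-strictly-mono f g a f≤g fa<ga = +-cancelʳ-≤ (f a) _ _ (begin
  suc (sum f) + f a ≡⟨ cong suc (+-comm (sum f) (f a)) ⟩
  suc (f a) + sum f ≡⟨ +-comm (suc (f a)) _ ⟩
  sum f + suc (f a) ≤⟨ +-monoʳ-≤ (sum f) fa<ga ⟩
  sum f + g a       ≤⟨ sum-mono-≤-except f g a (λ x _ → f≤g x) ⟩
  sum g + f a       ∎)
  where open ≤-Reasoning

sum≤1 : ∀ {n} (f : Fin n → ℕ) → (∀ x → f x ≤ 1) → (∀ x y → 1 ≤ f x → 1 ≤ f y → x ≡ y) → sum f ≤ 1
sum≤1 {zero} _ _ _ = z≤n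
sum≤1 {suc n} f f≤1 unique with f zero in eq
... | zero = sum≤1 (λ x → f (suc x)) (λ x → f≤1 (suc x)) (λ x y p q → suc-injective (unique (suc x) (suc y) p q))
... | suc zero = subst (λ s → 1 + s ≤ 1) (sym (sum-zero (λ x → f (suc x)) rest)) ≤-refl
  where
  rest : ∀ x → f (suc x) ≡ 0
  rest x with f (suc x) in eq′
  ... | zero = refl
  ... | suc _ with unique zero (suc x) (subst (1 ≤_) (sym eq) ≤-refl) (subst (1 ≤_) (sym eq′) (s≤s z≤n))
  ... | ()
... | suc (suc _) with f≤1 zero
... | f0≤1 rewrite eq with f0≤1
... | s≤s ()

δ : ∀ {n} → Fin n → Fin n → ℕ
δ a x = ⟦ does (x ≟F a) ⟧

δ-same : ∀ {n} (a : Fin n) → δ a a ≡ 1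
δ-same a rewrite dec-true (a ≟F a) refl = refl

δ≤1 : ∀ {n} (a x : Fin n) → δ a x ≤ 1
δ≤1 a x = ⟦⟧≤1 (does (x ≟F a))

δ-positive⁻ : ∀ {n} (a x : Fin n) → 1 ≤ δ a x → x ≡ a
δ-positive⁻ a x p = does-true⁻ (x ≟F a) (⟦⟧-positive⁻ p)

sum-δ : ∀ {n} (a : Fin n) → sum (δ a) ≡ 1
sum-δ a = ≤-antisym (sum≤1 (δ a) (δ≤1 a) λ x y p q → trans (δ-positive⁻ a x p) (sym (δ-positive⁻ a y q)))
                    (subst (_≤ sum (δ a)) (δ-same a) (term≤sum (δ a) a))

count : ∀ {a} → (Fin a → Bool) → ℕ
count P = sum (λ x → ⟦ P x ⟧)

fibre : ∀ {a m} → (Fin a → Bool) → (Fin a → Fin m) → Fin m → Fin a → ℕ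
fibre P f γ x = ⟦ P x ∧ does (γ ≟F f x) ⟧

count≡sum-fibres : ∀ {a m} (P : Fin a → Bool) (f : Fin a → Fin m) → count P ≡ sum (λ γ → sum (fibre P f γ))
count≡sum-fibres {m = m} P f = trans (sum-cong-≗ row) (∑-comm (λ x γ → fibre P f γ x))
  where
  row : ∀ x → ⟦ P x ⟧ ≡ sum (λ γ → fibre P f γ x)
  row x with P x
  ... | true = sym (sum-δ (f x))
  ... | false = sym (sum-zero {m} _ (λ _ → refl))

fibre-positive⁻ : ∀ {a m} (P : Fin a → Bool) (f : Fin a → Fin m) γ x → 1 ≤ fibre P f γ x → P x ≡ true × γ ≡ f x
fibre-positive⁻ P f γ x p with ∧-true⁻ {P x} (⟦⟧-positive⁻ p)
... | px , γ≡fx = px , does-true⁻ (γ ≟F f x) γ≡fx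

fibre≤1-injective : ∀ {a m} (P : Fin a → Bool) (f : Fin a → Fin m) →
  (∀ x y → P x ≡ true → P y ≡ true → f x ≡ f y → x ≡ y) → ∀ γ → sum (fibre P f γ) ≤ 1
fibre≤1-injective P f inj γ = sum≤1 (fibre P f γ) (λ x → ⟦⟧≤1 _) λ x y p q →
  let px , γ≡fx = fibre-positive⁻ P f γ x p
      py , γ≡fy = fibre-positive⁻ P f γ y q
  in inj x y px py (trans (sym γ≡fx) γ≡fy)

count≥-surjective : ∀ {a m} (P : Fin a → Bool) (f : Fin a → Fin m) →
  (∀ γ → ∃ λ x → P x ≡ true × f x ≡ γ) → m ≤ count P
count≥-surjective {m = m} P f surj = begin
  m                                  ≡⟨ sym (sum-const-1 m) ⟩
  sum {m} (λ _ → 1)                  ≤⟨ sum-mono-≤ fibre≥1 ⟩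
  sum (λ γ → sum (fibre P f γ))      ≡⟨ sym (count≡sum-fibres P f) ⟩
  count P                            ∎
  where
  open ≤-Reasoning
  fibre≥1 : ∀ γ → 1 ≤ sum (fibre P f γ)
  fibre≥1 γ with surj γ
  ... | x , px , refl = subst (λ b → ⟦ b ⟧ ≤ sum (fibre P f (f x))) (cong₂ _∧_ px (dec-true (f x ≟F f x) refl))
                          (term≤sum (fibre P f (f x)) x)

count₂≤-injective : ∀ {a b m} (P : Fin a → Fin b → Bool) (f : Fin a → Fin b → Fin m) →
  (∀ x y x′ y′ → P x y ≡ true → P x′ y′ ≡ true → f x y ≡ f x′ y′ → x ≡ x′ × y ≡ y′) →
  sum (λ x → count (P x)) ≤ m
count₂≤-injective {m = m} P f inj = begin
  sum (λ x → count (P x))                              ≡⟨ sum-cong-≗ (λ x → count≡sum-fibres (P x) (f x)) ⟩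
  sum (λ x → sum (λ γ → sum (fibre (P x) (f x) γ)))    ≡⟨ ∑-comm (λ x γ → sum (fibre (P x) (f x) γ)) ⟩
  sum (λ γ → sum (λ x → sum (fibre (P x) (f x) γ)))    ≤⟨ sum-mono-≤ color-class≤1 ⟩
  sum {m} (λ _ → 1)                                    ≡⟨ sum-const-1 m ⟩
  m                                                    ∎
  where
  open ≤-Reasoning
  color-class≤1 : ∀ γ → sum (λ x → sum (fibre (P x) (f x) γ)) ≤ 1
  color-class≤1 γ = sum≤1 _ (λ x → fibre≤1-injective (P x) (f x) (λ y y′ p q e → proj₂ (inj x y x y′ p q e)) γ)
    λ x x′ p q →
      let y , py = sum-positive⁻ _ p
          y′ , py′ = sum-positive⁻ _ q
          pxy , γ≡fxy = fibre-positive⁻ (P x) (f x) γ y py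
          px′y′ , γ≡fx′y′ = fibre-positive⁻ (P x′) (f x′) γ y′ py′
      in proj₁ (inj x y x′ y′ pxy px′y′ (trans (sym γ≡fxy) γ≡fx′y′))

degree≡sum : ∀ {n} (G : Graph n) v → degree G v ≡ sum (λ u → ⟦ adj G v u ⟧)
degree≡sum G v = trans (cong List.sum (map-tabulate (λ x → x) ⟦adj⟧)) (sum-tabulate ⟦adj⟧)
  where
  ⟦adj⟧ = λ u → ⟦ adj G v u ⟧
  sum-tabulate : ∀ {n} (f : Fin n → ℕ) → List.sum (tabulate f) ≡ sum f
  sum-tabulate {zero} _ = refl
  sum-tabulate {suc n} f = cong (f zero +_) (sum-tabulate (λ x → f (suc x)))

Star-closed : ∀ {n} {E : Fin n → Fin n → Set} (W : Fin n → Bool) → (∀ p q → W p ≡ true → E p q → W q ≡ true) →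
  ∀ {a b} → W a ≡ true → Star E a b → W b ≡ true
Star-closed W closed wa ε = wa
Star-closed W closed wa (e ◅ p) = Star-closed W closed (closed _ _ wa e) p

least : (P : ℕ → Set) → (∀ i → Dec (P i)) → ∀ N → P N → Σ ℕ λ i → P i × (∀ j → j < i → ¬ P j)
least P P? zero p = 0 , p , λ _ ()
least P P? (suc N) p with P? 0
... | yes p0 = 0 , p0 , λ _ ()
... | no ¬p0 with least (λ i → P (suc i)) (λ i → P? (suc i)) N p
... | i , pi , below = suc i , pi , λ { zero _ → ¬p0 ; (suc j) j<i → below j (s≤s⁻¹ j<i) }

argmax : ∀ {m} (P : Fin m → Bool) (f : Fin m → ℕ) → ∃ (λ y → P y ≡ true) →
         Σ (Fin m) λ v → P v ≡ true × (∀ y → P y ≡ true → f y ≤ f v)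
argmax {suc m} P f ex with any? (λ y → P (suc y) ≟B true)
... | no none = zero , P0 ex , λ { zero _ → ≤-refl ; (suc y) e → ⊥-elim (none (y , e)) }
  where
  P0 : ∃ (λ y → P y ≡ true) → P zero ≡ true
  P0 (zero , e) = e
  P0 (suc y , e) = ⊥-elim (none (y , e))
... | yes some with argmax (λ y → P (suc y)) (λ y → f (suc y)) some
... | v , Pv , max with P zero in P0
... | false = suc v , Pv , λ { zero e → ⊥-elim (true≢false e P0) ; (suc y) e → max y e }
... | true with ≤-total (f zero) (f (suc v))
... | inj₁ f0≤fv = suc v , Pv , λ { zero _ → f0≤fv ; (suc y) e → max y e }
... | inj₂ fv≤f0 = zero , P0 , λ { zero _ → ≤-refl ; (suc y) e → ≤-trans (max y e) fv≤f0 }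

dn-dec : ∀ {n} (P : Fin n → Set) → ¬ ¬ (∀ x → Dec (P x))
dn-dec {zero} P k = k (λ ())
dn-dec {suc n} P k = dec0 (λ d0 → dn-dec (λ x → P (suc x)) (λ ds → k (λ { zero → d0 ; (suc x) → ds x })))
  where
  dec0 : ¬ ¬ Dec (P zero)
  dec0 c = c (no (λ a → c (yes a)))

Reach-snoc : ∀ {n} {E : Fin n → Fin n → Bool} {a b c} → Reach E a b → E b c ≡ true → Reach E a c
Reach-snoc here e = step e here
Reach-snoc (step e p) e′ = step e (Reach-snoc p e′)

⁅_⁆ : ∀ {n} → Fin n → Fin n → Bool
⁅ v ⁆ x = does (x ≟F v)

⁅⁆-self : ∀ {n} (v : Fin n) → ⁅ v ⁆ v ≡ true
⁅⁆-self v = dec-true (v ≟F v) refl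

⁅⁆-other : ∀ {n} {v x : Fin n} → x ≢ v → ⁅ v ⁆ x ≡ false
⁅⁆-other {v = v} {x} = dec-false (x ≟F v)

⁅⁆-true⁻ : ∀ {n} {v x : Fin n} → ⁅ v ⁆ x ≡ true → x ≡ v
⁅⁆-true⁻ {v = v} {x} = does-true⁻ (x ≟F v)

insert : ∀ {n} → Fin n → (Fin n → Bool) → Fin n → Bool
insert v S x = S x ∨ ⁅ v ⁆ x

insert-self : ∀ {n} v (S : Fin n → Bool) → insert v S v ≡ true
insert-self v S = ∨-trueʳ (S v) (⁅⁆-self v)

insert-other : ∀ {n} {v x} (S : Fin n → Bool) → x ≢ v → insert v S x ≡ S x
insert-other S x≢v rewrite ⁅⁆-other x≢v = ∨-identityʳ _

insert-false⁻ : ∀ {n v x} (S : Fin n → Bool) → insert v S x ≡ false → S x ≡ false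
insert-false⁻ {x = x} S x∉S′ with S x
... | false = refl
... | true = x∉S′

insert-⊇ : ∀ {n} v (S : Fin n → Bool) {x} → S x ≡ true → insert v S x ≡ true
insert-⊇ v S {x} = ∨-trueˡ (⁅ v ⁆ x)

-- Vizing's theorem

Proper : ∀ {n m} {G : Graph n} → (Fin n → Fin n → Bool) → EdgeColoring G m → Set
Proper H c = ∀ z a b → H z a ≡ true → H z b ≡ true → col c z a ≡ col c z b → a ≡ b

module Colorings {n : ℕ} (G : Graph n) (C : ℕ) where

  V = Fin n
  Adj = V → V → Bool

  -- A partial coloring is a coloring of all pairs together with the subgraph H of colored edges.
  Coloring = EdgeColoring G C

  Missing : Adj → Coloring → V → Fin C → Set
  Missing H c z γ = ∀ y → H z y ≡ true → col c z y ≢ γ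

  SymmetricAdj : Adj → Set
  SymmetricAdj H = ∀ p q → H p q ≡ H q p

  IrreflexiveAdj : Adj → Set
  IrreflexiveAdj H = ∀ p → H p p ≡ false

  _⊑_ : Adj → Adj → Set
  H ⊑ H' = ∀ p q → H p q ≡ true → H' p q ≡ true

  proper-mono : ∀ {H H' : Adj} {c : Coloring} → H ⊑ H' → Proper H' c → Proper H c
  proper-mono s pr z a b h1 h2 e = pr z a b (s _ _ h1) (s _ _ h2) e

  missing-mono : ∀ {H H' c z γ} → H ⊑ H' → Missing H' c z γ → Missing H c z γ
  missing-mono s m y h = m y (s _ _ h)

  SameEdge : V → V → V → V → Set
  SameEdge a b p q = (p ≡ a × q ≡ b) ⊎ (p ≡ b × q ≡ a)

  sameEdge? : ∀ a b p q → Dec (SameEdge a b p q)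
  sameEdge? a b p q = ((p ≟F a) ×-dec (q ≟F b)) ⊎-dec ((p ≟F b) ×-dec (q ≟F a))

  opaque
    sameEdgeᵇ : V → V → V → V → Bool
    sameEdgeᵇ a b p q = does (sameEdge? a b p q)

    SameEdge-sym : ∀ {a b p q} → SameEdge a b p q → SameEdge a b q p
    SameEdge-sym (inj₁ (e1 , e2)) = inj₂ (e2 , e1)
    SameEdge-sym (inj₂ (e1 , e2)) = inj₁ (e2 , e1)

    sameEdgeᵇ-true : ∀ {a b p q} → SameEdge a b p q → sameEdgeᵇ a b p q ≡ true
    sameEdgeᵇ-true {a} {b} {p} {q} x = dec-true (sameEdge? a b p q) x
    sameEdgeᵇ-false : ∀ {a b p q} → ¬ SameEdge a b p q → sameEdgeᵇ a b p q ≡ false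
    sameEdgeᵇ-false {a} {b} {p} {q} x = dec-false (sameEdge? a b p q) x
    sameEdgeᵇ-true⁻ : ∀ {a b p q} → sameEdgeᵇ a b p q ≡ true → SameEdge a b p q
    sameEdgeᵇ-true⁻ {a} {b} {p} {q} e = does-true⁻ (sameEdge? a b p q) e

  sameEdgeᵇ-sym : ∀ a b p q → sameEdgeᵇ a b p q ≡ sameEdgeᵇ a b q p
  sameEdgeᵇ-sym a b p q with sameEdge? a b p q
  ... | yes x = trans (sameEdgeᵇ-true x) (sym (sameEdgeᵇ-true (SameEdge-sym x)))
  ... | no x = trans (sameEdgeᵇ-false x) (sym (sameEdgeᵇ-false (λ y → x (SameEdge-sym y))))

  opaque
    addEdge : Adj → V → V → Adj
    addEdge H a b p q = H p q ∨ sameEdgeᵇ a b p q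

    deleteEdge : Adj → V → V → Adj
    deleteEdge H a b p q = H p q ∧ not (sameEdgeᵇ a b p q)

    addEdge-true⁻ : ∀ {H a b p q} → addEdge H a b p q ≡ true → H p q ≡ true ⊎ SameEdge a b p q
    addEdge-true⁻ e with ∨-true⁻ e
    ... | inj₁ h = inj₁ h
    ... | inj₂ h = inj₂ (sameEdgeᵇ-true⁻ h)
    addEdge-old : ∀ {H a b p q} → H p q ≡ true → addEdge H a b p q ≡ true
    addEdge-old {H} {a} {b} {p} {q} h = ∨-trueˡ (sameEdgeᵇ a b p q) h
    addEdge-new : ∀ {H a b p q} → SameEdge a b p q → addEdge H a b p q ≡ true
    addEdge-new {H} {a} {b} {p} {q} x = ∨-trueʳ (H p q) (sameEdgeᵇ-true x)

    deleteEdge-true⁻ : ∀ {H a b p q} → deleteEdge H a b p q ≡ true → H p q ≡ true × ¬ SameEdge a b p q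
    deleteEdge-true⁻ e with ∧-true⁻ e
    ... | h , k = h , λ x → true≢false (sameEdgeᵇ-true x) (not-true⁻ k)
    deleteEdge-true⁺ : ∀ {H a b p q} → H p q ≡ true → ¬ SameEdge a b p q → deleteEdge H a b p q ≡ true
    deleteEdge-true⁺ h np = ∧-true⁺ h (not-true⁺ (sameEdgeᵇ-false np))
    deleteEdge-⊑ : ∀ {H a b} → deleteEdge H a b ⊑ H
    deleteEdge-⊑ {H} {a} {b} p q e = proj₁ (deleteEdge-true⁻ {H} {a} {b} e)

    addEdge-sym : ∀ {H} a b → SymmetricAdj H → SymmetricAdj (addEdge H a b)
    addEdge-sym {H} a b s p q = cong₂ _∨_ (s p q) (sameEdgeᵇ-sym a b p q)
    deleteEdge-sym : ∀ {H} a b → SymmetricAdj H → SymmetricAdj (deleteEdge H a b)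
    deleteEdge-sym {H} a b s p q = cong₂ _∧_ (s p q) (cong not (sameEdgeᵇ-sym a b p q))

    ¬SameEdge-loop : ∀ {a b p} → a ≢ b → ¬ SameEdge a b p p
    ¬SameEdge-loop ne (inj₁ (e1 , e2)) = ne (trans (sym e1) e2)
    ¬SameEdge-loop ne (inj₂ (e1 , e2)) = ne (trans (sym e2) e1)

    addEdge-irrefl : ∀ {H a b} → a ≢ b → IrreflexiveAdj H → IrreflexiveAdj (addEdge H a b)
    addEdge-irrefl {H} {a} {b} ne ir p rewrite ir p = sameEdgeᵇ-false (¬SameEdge-loop ne)
    deleteEdge-irrefl : ∀ {H a b} → IrreflexiveAdj H → IrreflexiveAdj (deleteEdge H a b)
    deleteEdge-irrefl {H} {a} {b} ir p rewrite ir p = refl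

  recolor : Coloring → V → V → Fin C → Coloring
  recolor c a b γ = record { col = λ p q → if sameEdgeᵇ a b p q then γ else col c p q
                       ; colSym = λ p q → cong₂ (λ x y → if x then γ else y) (sameEdgeᵇ-sym a b p q) (colSym c p q) }

  recolor-edge : ∀ c a b γ {p q} → SameEdge a b p q → col (recolor c a b γ) p q ≡ γ
  recolor-edge c a b γ x rewrite sameEdgeᵇ-true x = refl
  recolor-other : ∀ c a b γ {p q} → ¬ SameEdge a b p q → col (recolor c a b γ) p q ≡ col c p q
  recolor-other c a b γ x rewrite sameEdgeᵇ-false x = refl

  nonedge⇒¬SameEdge : ∀ {H a b z y} → SymmetricAdj H → H a b ≡ false → H z y ≡ true → ¬ SameEdge a b z y
  nonedge⇒¬SameEdge sy hab h (inj₁ (refl , refl)) = true≢false h hab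
  nonedge⇒¬SameEdge {a = a} {b} sy hab h (inj₂ (refl , refl)) = true≢false (trans (sy a b) h) hab

  SameEdge-missing : ∀ {H c a b z y γ} → Missing H c a γ → Missing H c b γ → SameEdge a b z y → Missing H c z γ
  SameEdge-missing ma mb (inj₁ (refl , _)) = ma
  SameEdge-missing ma mb (inj₂ (refl , _)) = mb

  addEdge-proper : ∀ {H c a b γ} → SymmetricAdj H → Proper H c → H a b ≡ false → a ≢ b →
        Missing H c a γ → Missing H c b γ → Proper (addEdge H a b) (recolor c a b γ)
  addEdge-proper {H} {c} {a} {b} {γ} sy pr hab ne ma mb z p q e1 e2 ce
    with addEdge-true⁻ {H} {a} {b} e1 | addEdge-true⁻ {H} {a} {b} e2
  ... | inj₁ h1 | inj₁ h2 = pr z p q h1 h2 (trans (sym (recolor-other c a b γ (nonedge⇒¬SameEdge sy hab h1))) (trans ce (recolor-other c a b γ (nonedge⇒¬SameEdge sy hab h2))))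
  ... | inj₂ x1 | inj₁ h2 = ⊥-elim (SameEdge-missing {H} {c} ma mb x1 q h2 (trans (sym (recolor-other c a b γ (nonedge⇒¬SameEdge sy hab h2))) (trans (sym ce) (recolor-edge c a b γ x1))))
  ... | inj₁ h1 | inj₂ x2 = ⊥-elim (SameEdge-missing {H} {c} ma mb x2 p h1 (trans (sym (recolor-other c a b γ (nonedge⇒¬SameEdge sy hab h1))) (trans ce (recolor-edge c a b γ x2))))
  ... | inj₂ (inj₁ (refl , refl)) | inj₂ (inj₁ (_ , refl)) = refl
  ... | inj₂ (inj₂ (refl , refl)) | inj₂ (inj₂ (_ , refl)) = refl
  ... | inj₂ (inj₁ (refl , refl)) | inj₂ (inj₂ (e , _)) = ⊥-elim (ne e)
  ... | inj₂ (inj₂ (refl , refl)) | inj₂ (inj₁ (e , _)) = ⊥-elim (ne (sym e))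

  module KempeSwap (α β : Fin C) (αβ : α ≢ β) where
    IsAB : Fin C → Set
    IsAB γ = γ ≡ α ⊎ γ ≡ β

    isAB? : ∀ γ → Dec (IsAB γ)
    isAB? γ = (γ ≟F α) ⊎-dec (γ ≟F β)

    swapAB : Fin C → Fin C
    swapAB γ with γ ≟F α
    ... | yes _ = β
    ... | no _ with γ ≟F β
    ... | yes _ = α
    ... | no _ = γ

    swapAB-IsAB : ∀ γ → IsAB γ → IsAB (swapAB γ)
    swapAB-IsAB γ ab with γ ≟F α
    ... | yes _ = inj₂ refl
    ... | no n1 with γ ≟F β
    ... | yes _ = inj₁ refl
    ... | no n2 with ab
    ... | inj₁ e = ⊥-elim (n1 e)
    ... | inj₂ e = ⊥-elim (n2 e)

    swapAB-involutive : ∀ γ → swapAB (swapAB γ) ≡ γ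
    swapAB-involutive γ with γ ≟F α
    swapAB-involutive γ | yes e with β ≟F α
    ... | yes e2 = ⊥-elim (αβ (sym e2))
    ... | no _ with β ≟F β
    ... | yes _ = sym e
    ... | no n = ⊥-elim (n refl)
    swapAB-involutive γ | no n1 with γ ≟F β
    swapAB-involutive γ | no n1 | yes e with α ≟F α
    ... | yes _ = sym e
    ... | no n = ⊥-elim (n refl)
    swapAB-involutive γ | no n1 | no n2 with γ ≟F α
    ... | yes e = ⊥-elim (n1 e)
    ... | no _ with γ ≟F β
    ... | yes e = ⊥-elim (n2 e)
    ... | no _ = refl

    swapABIf : Bool → Fin C → Fin C
    swapABIf false γ = γ
    swapABIf true γ with isAB? γ
    ... | yes _ = swapAB γ
    ... | no _ = γ

    swapABIf-other : ∀ b γ → ¬ IsAB γ → swapABIf b γ ≡ γ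
    swapABIf-other false γ _ = refl
    swapABIf-other true γ n with isAB? γ
    ... | yes a = ⊥-elim (n a)
    ... | no _ = refl

    swapABIf-involutive : ∀ b γ → swapABIf b (swapABIf b γ) ≡ γ
    swapABIf-involutive false γ = refl
    swapABIf-involutive true γ with isAB? γ
    ... | no n = swapABIf-other true γ n
    ... | yes a with isAB? (swapAB γ)
    ... | yes _ = swapAB-involutive γ
    ... | no n = ⊥-elim (n (swapAB-IsAB γ a))

    swapABIf-α : swapABIf true α ≡ β
    swapABIf-α with isAB? α
    ... | no n = ⊥-elim (n (inj₁ refl))
    ... | yes _ with α ≟F α
    ... | yes _ = refl
    ... | no n = ⊥-elim (n refl)

    swapABIf-injective : ∀ b {γ γ'} → swapABIf b γ ≡ swapABIf b γ' → γ ≡ γ'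
    swapABIf-injective b {γ} {γ'} e = trans (sym (swapABIf-involutive b γ)) (trans (cong (swapABIf b) e) (swapABIf-involutive b γ'))

    module _ (H : Adj) (c : Coloring) (W : V → Bool) (sy : SymmetricAdj H)
             (closed : ∀ p q → W p ≡ true → H p q ≡ true → IsAB (col c p q) → W q ≡ true) where

      -- The swap on an edge is decided at its first end; W being closed under (α,β)-edges makes it symmetric.
      kempeCol : V → V → Fin C
      kempeCol p q = swapABIf (W p ∧ H p q) (col c p q)

      closed-both-ends : ∀ p q → H p q ≡ true → IsAB (col c p q) → W p ≡ W q
      closed-both-ends p q h ab with W p in e1 | W q in e2
      ... | true | true = refl
      ... | false | false = refl
      ... | true | false = ⊥-elim (true≢false (closed p q e1 h ab) e2)
      ... | false | true = ⊥-elim (true≢false (closed q p e2 (trans (sy q p) h) (subst IsAB (colSym c p q) ab)) e1)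

      kempeCol-sym : ∀ p q → kempeCol p q ≡ kempeCol q p
      kempeCol-sym p q with H p q in h
      ... | false rewrite sy q p | h | ∧-zeroʳ (W p) | ∧-zeroʳ (W q) = colSym c p q
      ... | true with isAB? (col c p q)
      ... | no n rewrite swapABIf-other (W p ∧ true) (col c p q) n | swapABIf-other (W q ∧ H q p) (col c q p) (λ a → n (subst IsAB (colSym c q p) a)) = colSym c p q
      ... | yes a rewrite sy q p | h | closed-both-ends p q h a | colSym c p q | ∧-identityʳ (W q) = refl

      kempe : Coloring
      kempe = record { col = kempeCol ; colSym = kempeCol-sym }

      kempe-at : ∀ z y → H z y ≡ true → col kempe z y ≡ swapABIf (W z) (col c z y)
      kempe-at z y h = cong (λ b → swapABIf b (col c z y)) (trans (cong (W z ∧_) h) (∧-identityʳ (W z)))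

      kempe-proper : Proper H c → Proper H kempe
      kempe-proper pr z a b h1 h2 e = pr z a b h1 h2 (swapABIf-injective (W z) (trans (sym (kempe-at z a h1)) (trans e (kempe-at z b h2))))

      kempe-missing : ∀ z γ → Missing H c z (swapABIf (W z) γ) → Missing H kempe z γ
      kempe-missing z γ m y h e = m y h (trans (sym (swapABIf-involutive (W z) (col c z y))) (cong (swapABIf (W z)) (trans (sym (kempe-at z y h)) e)))

      kempe-outside : ∀ z y → W z ≡ false → col kempe z y ≡ col c z y
      kempe-outside z y e rewrite e = refl

module AlternatingPaths {n : ℕ} (G : Graph n) (C : ℕ) where
  open Colorings G C

  Present : Adj → Coloring → V → Fin C → Set
  Present H c z γ = ∃ λ y → H z y ≡ true × col c z y ≡ γ

  present? : ∀ H c z γ → Dec (Present H c z γ)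
  present? H c z γ = any? (λ y → (H z y ≟B true) ×-dec (col c z y ≟F γ))

  present⇒¬missing : ∀ {H c z γ} → Present H c z γ → ¬ Missing H c z γ
  present⇒¬missing (y , h , e) m = m y h e
  ¬present⇒missing : ∀ {H c z γ} → ¬ Present H c z γ → Missing H c z γ
  ¬present⇒missing na y h e = na (y , h , e)
  ¬missing⇒present : ∀ {H c z γ} → ¬ Missing H c z γ → Present H c z γ
  ¬missing⇒present {H} {c} {z} {γ} nm = decidable-stable (present? H c z γ) (λ na → nm (¬present⇒missing {H} {c} {z} {γ} na))

  missing? : ∀ H c z γ → Dec (Missing H c z γ)
  missing? H c z γ with present? H c z γ
  ... | yes a = no (present⇒¬missing {H} {c} {z} {γ} a)
  ... | no na = yes (¬present⇒missing {H} {c} {z} {γ} na)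

  -- the neighbor of z along the edge of color γ, or z itself if there is none
  follow : Adj → Coloring → V → Fin C → V
  follow H c z γ with present? H c z γ
  ... | yes (y , _) = y
  ... | no _ = z

  follow-spec : ∀ H c z γ → Present H c z γ → H z (follow H c z γ) ≡ true × col c z (follow H c z γ) ≡ γ
  follow-spec H c z γ a with present? H c z γ
  ... | yes (y , p) = p
  ... | no na = ⊥-elim (na a)

  OneOf : Fin C → Fin C → Fin C → Set
  OneOf δ0 δ1 γ = γ ≡ δ0 ⊎ γ ≡ δ1

  AltEdge : Adj → Coloring → Fin C → Fin C → V → V → Set
  AltEdge H c δ0 δ1 p q = H p q ≡ true × OneOf δ0 δ1 (col c p q)

  odd : ℕ → Bool
  odd zero = false
  odd (suc i) = not (odd i)

  -- The path from s alternating between the colors δ0 and δ1, starting with δ0, followed as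
  -- long as possible. Since δ1 is missing at s, it never revisits a vertex.
  module MaximalPath (H : Adj) (c : Coloring) (sy : SymmetricAdj H) (ir : IrreflexiveAdj H) (pr : Proper H c)
              (s : V) (δ0 δ1 : Fin C) (d01 : δ0 ≢ δ1) (ms : Missing H c s δ1) where

    color : ℕ → Fin C
    color i = if odd i then δ1 else δ0

    color-OneOf : ∀ i → OneOf δ0 δ1 (color i)
    color-OneOf i with odd i
    ... | true = inj₂ refl
    ... | false = inj₁ refl

    color-alternates : ∀ i → color (suc i) ≢ color i
    color-alternates i with odd i
    ... | true = λ e → d01 e
    ... | false = λ e → d01 (sym e)

    color-period : ∀ i → color (suc (suc i)) ≡ color i
    color-period i with odd i
    ... | true = refl
    ... | false = refl

    color-other : ∀ i γ → OneOf δ0 δ1 γ → γ ≢ color i → γ ≡ color (suc i)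
    color-other i γ ab ne with odd i | ab
    ... | true | inj₁ e = e
    ... | true | inj₂ e = ⊥-elim (ne e)
    ... | false | inj₁ e = ⊥-elim (ne e)
    ... | false | inj₂ e = e

    vertex : ℕ → V
    vertex zero = s
    vertex (suc i) = follow H c (vertex i) (color i)

    Continues : ℕ → Set
    Continues i = Present H c (vertex i) (color i)

    forward : ∀ i → Continues i → H (vertex i) (vertex (suc i)) ≡ true × col c (vertex i) (vertex (suc i)) ≡ color i
    forward i a = follow-spec H c (vertex i) (color i) a

    backward : ∀ i → Continues i → H (vertex (suc i)) (vertex i) ≡ true × col c (vertex (suc i)) (vertex i) ≡ color i
    backward i a = trans (sy _ _) (proj₁ (forward i a)) , trans (colSym c _ _) (proj₂ (forward i a))

    vertices-distinct : ∀ j i → (∀ i → i < j → Continues i) → i < j → vertex i ≡ vertex j → ⊥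
    vertices-distinct-step : ∀ j i → (∀ i → i < j → Continues i) → i < j → H (vertex i) (vertex j) ≡ true → col c (vertex i) (vertex j) ≡ color j → ⊥
    vertices-distinct zero i continues () e
    vertices-distinct (suc j) i continues lt e with forward j (continues j ≤-refl) | i ≟N j
    ... | hj , cj | yes refl = true≢false (subst (λ v → H (vertex i) v ≡ true) (sym e) hj) (ir (vertex i))
    ... | hj , cj | no ne = vertices-distinct-step j i (λ i l → continues i (≤-trans l (n≤1+n _))) (≤∧≢⇒< (s≤s⁻¹ lt) ne)
          (subst (λ v → H v (vertex j) ≡ true) (sym e) (trans (sy _ _) hj))
          (subst (λ v → col c v (vertex j) ≡ color j) (sym e) (trans (colSym c _ _) cj))
    vertices-distinct-step j i act' i<j hz cz with forward i (act' i i<j) | color j ≟F color i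
    ... | hi , ci | yes ce with suc i ≟N j
    ... | yes refl = color-alternates i ce
    ... | no ne2 = vertices-distinct j (suc i) act' (≤∧≢⇒< i<j ne2) (sym (pr (vertex i) (vertex j) (vertex (suc i)) hz hi (trans cz (trans ce (sym ci)))))
    vertices-distinct-step j zero act' i<j hz cz | hi , ci | no cne = ms (vertex j) hz (trans cz (color-other 0 (color j) (color-OneOf j) cne))
    vertices-distinct-step j (suc i') act' i<j hz cz | hi , ci | no cne =
      vertices-distinct j i' act' (<-trans (n<1+n _) i<j)
        (sym (pr (vertex (suc i')) (vertex j) (vertex i') hz (proj₁ (backward i' a))
           (trans cz (trans (trans (color-other (suc i') (color j) (color-OneOf j) cne) (color-period i')) (sym (proj₂ (backward i' a)))))))
      where a = act' i' (<-trans (n<1+n _) i<j)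

    opaque
     stopping-time : Σ ℕ λ len → ¬ Continues len × (∀ i → i < len → Continues i)
     stopping-time with pigeonhole (≤-refl {suc n}) (λ (i : Fin (suc n)) → vertex (toℕ i))
     ... | i , j , i<j , e with anyUpTo? (λ i → ¬? (present? H c (vertex i) (color i))) (toℕ j)
     ... | no none = ⊥-elim (vertices-distinct (toℕ j) (toℕ i) (λ i l → decidable-stable (present? H c (vertex i) (color i)) (λ na → none (i , l , na))) i<j e)
     ... | yes (N , _ , pN) with least (λ i → ¬ Continues i) (λ i → ¬? (present? H c (vertex i) (color i))) N pN
     ... | len , pt , f = len , pt , λ i l → decidable-stable (present? H c (vertex i) (color i)) (f i l)

    len : ℕ
    len = proj₁ stopping-time
    stops : ¬ Continues len
    stops = proj₁ (proj₂ stopping-time)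
    continues : ∀ i → i < len → Continues i
    continues = proj₂ (proj₂ stopping-time)

    OnPath : V → Bool
    OnPath z = does (any? (λ (i : Fin (suc len)) → vertex (toℕ i) ≟F z))

    OnPath-true⁻ : ∀ z → OnPath z ≡ true → ∃ λ i → i ≤ len × vertex i ≡ z
    OnPath-true⁻ z e with does-true⁻ (any? (λ (i : Fin (suc len)) → vertex (toℕ i) ≟F z)) e
    ... | i , p = toℕ i , s≤s⁻¹ (toℕ<n i) , p

    OnPath-true⁺ : ∀ i z → i ≤ len → vertex i ≡ z → OnPath z ≡ true
    OnPath-true⁺ i z le e = dec-true (any? (λ (i : Fin (suc len)) → vertex (toℕ i) ≟F z)) (fromℕ< (s≤s le) , trans (cong vertex (toℕ-fromℕ< (s≤s le))) e)

    OnPath-start : OnPath s ≡ true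
    OnPath-start = OnPath-true⁺ 0 s z≤n refl

    OnPath-closed : ∀ p q → OnPath p ≡ true → AltEdge H c δ0 δ1 p q → OnPath q ≡ true
    OnPath-closed p q wp (h , ab) with OnPath-true⁻ p wp
    ... | i , le , refl with col c (vertex i) q ≟F color i
    ... | yes ce with i ≟N len
    ... | yes e2 = ⊥-elim (stops (subst (λ i → Continues i) e2 (q , h , ce)))
    ... | no ne = OnPath-true⁺ (suc i) q (≤∧≢⇒< le ne) (sym (pr (vertex i) q (vertex (suc i)) h (proj₁ (forward i a)) (trans ce (sym (proj₂ (forward i a))))))
      where a = continues i (≤∧≢⇒< le ne)
    OnPath-closed p q wp (h , ab) | i , le , refl | no cne with i
    ... | zero = ⊥-elim (ms q h (color-other 0 (col c s q) ab cne))
    ... | suc i' = OnPath-true⁺ i' q (≤-trans (n≤1+n _) le) (sym (pr (vertex (suc i')) q (vertex i') h (proj₁ (backward i' a))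
                       (trans (trans (color-other (suc i') _ ab cne) (color-period i')) (sym (proj₂ (backward i' a))))))
      where a = continues i' le

    reaches-start : ∀ i → i ≤ len → Star (AltEdge H c δ0 δ1) (vertex i) s
    reaches-start zero _ = ε
    reaches-start (suc i) le = (proj₁ (backward i a) , subst (OneOf δ0 δ1) (sym (proj₂ (backward i a))) (color-OneOf i)) ◅ reaches-start i (≤-trans (n≤1+n _) le)
      where a = continues i le

    missing-end : ∀ z γ → OnPath z ≡ true → Missing H c z γ → OneOf δ0 δ1 γ → z ≢ s → z ≡ vertex len
    missing-end z γ wz m ab ns with OnPath-true⁻ z wz
    ... | zero , le , e = ⊥-elim (ns (sym e))
    ... | suc i , le , e with suc i ≟N len
    ... | yes e2 = trans (sym e) (cong vertex e2)
    ... | no ne with γ ≟F color (suc i)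
    ... | yes ge = ⊥-elim (m (vertex (suc (suc i))) (subst (λ v → H v _ ≡ true) e (proj₁ (forward (suc i) a))) (trans (cong (λ v → col c v _) (sym e)) (trans (proj₂ (forward (suc i) a)) (sym ge))))
      where a = continues (suc i) (≤∧≢⇒< le ne)
    ... | no gne = ⊥-elim (m (vertex i) (subst (λ v → H v _ ≡ true) e (proj₁ (backward i a))) (trans (cong (λ v → col c v _) (sym e)) (trans (proj₂ (backward i a)) (sym (trans (color-other (suc i) γ ab gne) (color-period i))))))
      where a = continues i le

module FanRotation {n : ℕ} (G : Graph n) (C : ℕ) where
  open Colorings G C
  open AlternatingPaths G C

  missing-transfer : ∀ {H c a b a' b' γ' z δ} → z ≢ a → z ≢ b → Missing H c z δ →
            Missing (addEdge (deleteEdge H a' b') a b) (recolor c a b γ') z δ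
  missing-transfer {H} {c} {a} {b} {a'} {b'} {γ'} {z} za zb m y h e with addEdge-true⁻ {deleteEdge H a' b'} {a} {b} h
  ... | inj₁ h1 = m y (proj₁ (deleteEdge-true⁻ {H} {a'} {b'} h1)) (trans (sym (recolor-other c a b γ' np)) e)
    where np : ¬ SameEdge a b z y
          np (inj₁ (e1 , _)) = za e1
          np (inj₂ (e1 , _)) = zb e1
  ... | inj₂ (inj₁ (e1 , _)) = za e1
  ... | inj₂ (inj₂ (e1 , _)) = zb e1

  Fan : Adj → Coloring → V → (ℕ → V) → (ℕ → Fin C) → ℕ → Set
  Fan H c x F B j = ∀ i → i < j → H x (F (suc i)) ≡ true × col c x (F (suc i)) ≡ B i × Missing H c (F i) (B i)

  -- Shifting the fan: for i < j the edge x F(i) takes the color B i of x F(i+1), and the edge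
  -- x F(j), freed in this way, gets γ, which is missing at both of its ends.
  rotate-fan : ∀ j (H : Adj) (c : Coloring) x (F : ℕ → V) (B : ℕ → Fin C) γ → SymmetricAdj H → IrreflexiveAdj H → Proper H c →
        H x (F 0) ≡ false → (∀ i → i ≤ j → F i ≢ x) →
        (∀ i i' → i ≤ j → i' ≤ j → F i ≡ F i' → i ≡ i') →
        Fan H c x F B j →
        Missing H c x γ → Missing H c (F j) γ → Σ Coloring (λ c' → Proper (addEdge H x (F 0)) c')
  rotate-fan zero H c x F B γ sy ir pr hx0 nx inj fan mx mF =
    recolor c x (F 0) γ , addEdge-proper {H} {c} {x} {F 0} {γ} sy pr hx0 (λ e → nx 0 z≤n (sym e)) mx mF
  rotate-fan (suc j) H c x F B γ sy ir pr hx0 nx inj fan mx mF =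
    proj₁ IH , proper-mono {addEdge H x (F 0)} {addEdge H' x (F 1)} {proj₁ IH} sub (proj₂ IH)
    where
    H1 = deleteEdge H x (F 1)
    H' = addEdge H1 x (F 0)
    c' = recolor c x (F 0) (B 0)
    x0 : x ≢ F 0
    x0 e = nx 0 z≤n (sym e)
    f0 = fan 0 (s≤s z≤n)
    hx1 = proj₁ f0
    cx1 = proj₁ (proj₂ f0)
    m0 = proj₂ (proj₂ f0)
    Fi-ne : ∀ {i i'} → i ≤ suc j → i' ≤ suc j → i ≢ i' → F i ≢ F i'
    Fi-ne l1 l2 ne e = ne (inj _ _ l1 l2 e)
    h1x0 : H1 x (F 0) ≡ false
    h1x0 = ¬true⇒false (λ e → true≢false (proj₁ (deleteEdge-true⁻ {H} {x} {F 1} e)) hx0)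
    missX : Missing H1 c x (B 0)
    missX y h e with deleteEdge-true⁻ {H} {x} {F 1} h
    ... | hy , np = np (inj₁ (refl , pr x y (F 1) hy hx1 (trans e (sym cx1))))
    pr' : Proper H' c'
    pr' = addEdge-proper {H1} {c} {x} {F 0} {B 0} (deleteEdge-sym x (F 1) sy) (proper-mono {H1} {H} {c} (deleteEdge-⊑ {H} {x} {F 1}) pr) h1x0 x0 missX
            (missing-mono {H1} {H} {c} {F 0} {B 0} (deleteEdge-⊑ {H} {x} {F 1}) m0)
    sy' : SymmetricAdj H'
    sy' = addEdge-sym x (F 0) (deleteEdge-sym x (F 1) sy)
    ir' : IrreflexiveAdj H'
    ir' = addEdge-irrefl {H1} {x} {F 0} x0 (deleteEdge-irrefl {H} {x} {F 1} ir)
    hx1' : H' x (F 1) ≡ false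
    hx1' = ¬true⇒false λ e → case (addEdge-true⁻ {H1} {x} {F 0} e)
      where case : _ → ⊥
            case (inj₁ h) = proj₂ (deleteEdge-true⁻ {H} {x} {F 1} h) (inj₁ (refl , refl))
            case (inj₂ (inj₁ (_ , e2))) = Fi-ne (s≤s z≤n) z≤n (λ ()) e2
            case (inj₂ (inj₂ (e1 , _))) = x0 e1
    F' : ℕ → V
    F' i = F (suc i)
    B' : ℕ → Fin C
    B' i = B (suc i)
    nx' : ∀ i → i ≤ j → F' i ≢ x
    nx' i l = nx (suc i) (s≤s l)
    inj' : ∀ i i' → i ≤ j → i' ≤ j → F' i ≡ F' i' → i ≡ i'
    inj' i i' l1 l2 e = cong pred (inj (suc i) (suc i') (s≤s l1) (s≤s l2) e)
    fan' : Fan H' c' x F' B' j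
    fan' i l with fan (suc i) (s≤s l)
    ... | h , cl , m = addEdge-old {H1} {x} {F 0} (deleteEdge-true⁺ {H} {x} {F 1} h np1) , trans (recolor-other c x (F 0) (B 0) np0) cl ,
                       missing-transfer {H} {c} {x} {F 0} {x} {F 1} {B 0} (nx (suc i) (s≤s (≤-trans (n≤1+n _) l))) (Fi-ne (s≤s (≤-trans (n≤1+n _) l)) z≤n (λ ())) m
      where
      np1 : ¬ SameEdge x (F 1) x (F (suc (suc i)))
      np1 (inj₁ (_ , e)) = Fi-ne (s≤s l) (s≤s z≤n) (λ ()) e
      np1 (inj₂ (e , _)) = nx 1 (s≤s z≤n) (sym e)
      np0 : ¬ SameEdge x (F 0) x (F (suc (suc i)))
      np0 (inj₁ (_ , e)) = Fi-ne (s≤s l) z≤n (λ ()) e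
      np0 (inj₂ (e , _)) = x0 e
    mx' : Missing H' c' x γ
    mx' y h e with addEdge-true⁻ {H1} {x} {F 0} h
    ... | inj₁ h1 = mx y (proj₁ (deleteEdge-true⁻ {H} {x} {F 1} h1)) (trans (sym (recolor-other c x (F 0) (B 0) np)) e)
      where np : ¬ SameEdge x (F 0) x y
            np (inj₁ (_ , refl)) = true≢false (proj₁ (deleteEdge-true⁻ {H} {x} {F 1} h1)) hx0
            np (inj₂ (e1 , _)) = x0 e1
    ... | inj₂ pp = mx (F 1) hx1 (trans cx1 (trans (sym (recolor-edge c x (F 0) (B 0) pp)) e))
    mF' : Missing H' c' (F' j) γ
    mF' = missing-transfer {H} {c} {x} {F 0} {x} {F 1} {B 0} (nx (suc j) ≤-refl) (Fi-ne ≤-refl z≤n (λ ())) mF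
    IH = rotate-fan j H' c' x F' B' γ sy' ir' pr' hx1' nx' inj' fan' mx' mF'
    sub : addEdge H x (F 0) ⊑ addEdge H' x (F 1)
    sub p q e with addEdge-true⁻ {H} {x} {F 0} e
    ... | inj₂ pp = addEdge-old {H'} {x} {F 1} (addEdge-new {H1} {x} {F 0} pp)
    ... | inj₁ h with sameEdge? x (F 1) p q
    ... | yes pp = addEdge-new {H'} {x} {F 1} pp
    ... | no np = addEdge-old {H'} {x} {F 1} (addEdge-old {H1} {x} {F 0} (deleteEdge-true⁺ {H} {x} {F 1} h np))

module VizingStep {n : ℕ} (G : Graph n) (C : ℕ) where
  open Colorings G C
  open AlternatingPaths G C
  open FanRotation G C

  -- Vizing's fan at x, where α is missing: F 0 = y0, and x F(i+1) is the edge of color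
  -- B i = m (F i), which is missing at F i. At the first stop l either B l is missing at x and
  -- the fan rotates, or F(l+1) = F(j'+1), so B l = B j' = β. The (β,α)-path from x ends at no
  -- more than one of F j', F l; swapping α and β on the path from the other one makes α missing
  -- there while it stays missing at x.
  module _ (H : Adj) (c : Coloring) (sy : SymmetricAdj H) (ir : IrreflexiveAdj H) (pr : Proper H c)
           (m : V → Fin C) (missing-spec : ∀ z → Missing H c z (m z))
           (x y0 : V) (hx0 : H x y0 ≡ false) (nx0 : x ≢ y0) where

    α = m x
    mα = missing-spec x

    F : ℕ → V
    F zero = y0
    F (suc i) = follow H c x (m (F i))

    B : ℕ → Fin C
    B i = m (F i)

    FanStops : ℕ → Set
    FanStops i = Missing H c x (B i) ⊎ (∃ λ j → j < suc i × F (suc i) ≡ F j)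

    FanStops? : ∀ i → Dec (FanStops i)
    FanStops? i with missing? H c x (B i) | anyUpTo? (λ j → F (suc i) ≟F F j) (suc i)
    ... | yes p | _ = yes (inj₁ p)
    ... | no _ | yes q = yes (inj₂ q)
    ... | no np | no nq = no λ { (inj₁ p) → np p ; (inj₂ q) → nq q }

    repeat⇒stops : ∀ a b → a < b → F a ≡ F b → ∃ FanStops
    repeat⇒stops a (suc b) lt e = b , inj₂ (a , lt , sym e)

    opaque
     fan-stops : ∃ FanStops
     fan-stops with pigeonhole (≤-refl {suc n}) (λ (i : Fin (suc n)) → F (toℕ i))
     ... | i , j , lt , e = repeat⇒stops (toℕ i) (toℕ j) lt e

    opaque
      first-stop : Σ ℕ λ i → FanStops i × (∀ j → j < i → ¬ FanStops j)
      first-stop = least FanStops FanStops? (proj₁ fan-stops) (proj₂ fan-stops)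
    l = proj₁ first-stop
    stops-at-l = proj₁ (proj₂ first-stop)
    runs-before-l = proj₂ (proj₂ first-stop)

    fan-continues : ∀ i → i < l → Present H c x (B i)
    fan-continues i lt = ¬missing⇒present {H} {c} {x} {B i} (λ mm → runs-before-l i lt (inj₁ mm))

    fan-edge : ∀ i → i < l → H x (F (suc i)) ≡ true
    fan-edge i lt = proj₁ (follow-spec H c x (B i) (fan-continues i lt))
    fan-color : ∀ i → i < l → col c x (F (suc i)) ≡ B i
    fan-color i lt = proj₂ (follow-spec H c x (B i) (fan-continues i lt))

    fan-no-repeat : ∀ i → i < l → ∀ j → j < suc i → F (suc i) ≢ F j
    fan-no-repeat i lt j le e = runs-before-l i lt (inj₂ (j , le , e))

    fan-injective : ∀ a b → a ≤ l → b ≤ l → F a ≡ F b → a ≡ b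
    fan-injective a b la lb e with <-cmp a b
    ... | tri≈ _ eq _ = eq
    fan-injective a (suc b') la lb e | tri< lt _ _ = ⊥-elim (fan-no-repeat b' lb a lt (sym e))
    fan-injective (suc a') b la lb e | tri> _ _ gt = ⊥-elim (fan-no-repeat a' la b gt e)

    fan≢x : ∀ i → i ≤ l → F i ≢ x
    fan≢x zero _ e = nx0 (sym e)
    fan≢x (suc i) le e = true≢false (subst (λ v → H x v ≡ true) e (fan-edge i le)) (ir x)

    fan-prefix : ∀ j → (∀ i → i < j → i < l) → Fan H c x F B j
    fan-prefix j f i lt = fan-edge i (f i lt) , fan-color i (f i lt) , missing-spec (F i)

    AltEdge-swap : ∀ {a b p q} → AltEdge H c a b p q → AltEdge H c b a p q
    AltEdge-swap (h , inj₁ e) = h , inj₂ e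
    AltEdge-swap (h , inj₂ e) = h , inj₁ e

    AltEdge-sym : ∀ {a b p q} → AltEdge H c a b p q → AltEdge H c a b q p
    AltEdge-sym {p = p} {q} (h , ab) = trans (sy q p) h , subst (OneOf _ _) (colSym c p q) ab

    module RepeatedColor (j' : ℕ) (j'<l : j' < l) (hxl : H x (F (suc l)) ≡ true) (cxl : col c x (F (suc l)) ≡ B l)
             (e : F (suc l) ≡ F (suc j')) where
      β = B l
      Bj'β : B j' ≡ β
      Bj'β = trans (sym (fan-color j' j'<l)) (trans (cong (col c x) (sym e)) cxl)
      αβ : α ≢ β
      αβ eq = mα (F (suc l)) hxl (trans cxl (sym eq))
      Bi-β : ∀ i → i < l → B i ≡ β → i ≡ j'
      Bi-β i lt eq = cong pred (fan-injective (suc i) (suc j') lt j'<l (trans (pr x (F (suc i)) (F (suc l)) (fan-edge i lt) hxl (trans (fan-color i lt) (trans eq (sym cxl)))) e))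
      Bi-α : ∀ i → i < l → B i ≢ α
      Bi-α i lt eq = mα (F (suc i)) (fan-edge i lt) (trans (fan-color i lt) eq)
      mj' : Missing H c (F j') β
      mj' = subst (Missing H c (F j')) Bj'β (missing-spec (F j'))
      ml : Missing H c (F l) β
      ml = missing-spec (F l)

      module WX = MaximalPath H c sy ir pr x β α (λ eq → αβ (sym eq)) mα

      open KempeSwap α β αβ

      path-avoids-Fj′ : WX.OnPath (F j') ≡ false → Σ Coloring (λ c' → Proper (addEdge H x y0) c')
      path-avoids-Fj′ wf = rotate-fan j' H c' x F B α sy ir (kempe-proper H c W1.OnPath sy cl pr) hx0 (λ i le → fan≢x i (≤-trans le (<⇒≤ j'<l)))
                   (λ a b la lb → fan-injective a b (≤-trans la (<⇒≤ j'<l)) (≤-trans lb (<⇒≤ j'<l))) fan1 mx1 mF1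
        where
        module W1 = MaximalPath H c sy ir pr (F j') α β αβ mj'
        cl : ∀ p q → W1.OnPath p ≡ true → H p q ≡ true → IsAB (col c p q) → W1.OnPath q ≡ true
        cl p q wp h ab = W1.OnPath-closed p q wp (h , ab)
        x∉ : W1.OnPath x ≡ false
        x∉ = ¬true⇒false λ wx → help (W1.OnPath-true⁻ x wx)
          where help : _ → ⊥
                help (i , le , ei) = true≢false (Star-closed WX.OnPath WX.OnPath-closed WX.OnPath-start
                    (Star.map AltEdge-swap (subst (λ v → Star _ v (F j')) ei (W1.reaches-start i le)))) wf
        c' = kempe H c W1.OnPath sy cl
        fan1 : Fan H c' x F B j'
        fan1 i lt = fan-edge i il , trans (kempe-outside H c W1.OnPath sy cl x _ x∉) (fan-color i il) ,
                    kempe-missing H c W1.OnPath sy cl (F i) (B i) (subst (Missing H c (F i)) (sym (swapABIf-other (W1.OnPath (F i)) (B i) nab)) (missing-spec (F i)))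
          where il = <-trans lt j'<l
                nab : ¬ IsAB (B i)
                nab (inj₁ eq) = Bi-α i il eq
                nab (inj₂ eq) = <-irrefl (Bi-β i il eq) lt
        mx1 : Missing H c' x α
        mx1 = kempe-missing H c W1.OnPath sy cl x α (subst (λ b → Missing H c x (swapABIf b α)) (sym x∉) mα)
        mF1 : Missing H c' (F j') α
        mF1 = kempe-missing H c W1.OnPath sy cl (F j') α (subst (λ b → Missing H c (F j') (swapABIf b α)) (sym W1.OnPath-start) (subst (Missing H c (F j')) (sym swapABIf-α) mj'))

      path-reaches-Fj′ : WX.OnPath (F j') ≡ true → Σ Coloring (λ c' → Proper (addEdge H x y0) c')
      path-reaches-Fj′ wt = rotate-fan l H c' x F B α sy ir (kempe-proper H c W2.OnPath sy cl pr) hx0 fan≢x fan-injective fan2 mx2 mF2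
        where
        Fl∉ : WX.OnPath (F l) ≡ false
        Fl∉ = ¬true⇒false λ wl → <-irrefl (fan-injective j' l (<⇒≤ j'<l) ≤-refl
                 (trans (WX.missing-end (F j') β wt mj' (inj₁ refl) (fan≢x j' (<⇒≤ j'<l))) (sym (WX.missing-end (F l) β wl ml (inj₁ refl) (fan≢x l ≤-refl))))) j'<l
        module W2 = MaximalPath H c sy ir pr (F l) α β αβ ml
        cl : ∀ p q → W2.OnPath p ≡ true → H p q ≡ true → IsAB (col c p q) → W2.OnPath q ≡ true
        cl p q wp h ab = W2.OnPath-closed p q wp (h , ab)
        x∉2 : W2.OnPath x ≡ false
        x∉2 = ¬true⇒false λ wx → help (W2.OnPath-true⁻ x wx)
          where help : _ → ⊥
                help (i , le , ei) = true≢false (Star-closed WX.OnPath WX.OnPath-closed WX.OnPath-start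
                    (Star.map AltEdge-swap (subst (λ v → Star _ v (F l)) ei (W2.reaches-start i le)))) Fl∉
        j∉2 : W2.OnPath (F j') ≡ false
        j∉2 = ¬true⇒false λ wj → help (W2.OnPath-true⁻ (F j') wj) (WX.OnPath-true⁻ (F j') wt)
          where help : _ → _ → ⊥
                help (i , le , ei) (i2 , le2 , ei2) =
                  true≢false (Star-closed WX.OnPath WX.OnPath-closed WX.OnPath-start
                    (_◅◅_ (Star.reverse AltEdge-sym (subst (λ v → Star _ v x) ei2 (WX.reaches-start i2 le2)))
                              (Star.map AltEdge-swap (subst (λ v → Star _ v (F l)) ei (W2.reaches-start i le))))) Fl∉
        c' = kempe H c W2.OnPath sy cl
        fan2 : Fan H c' x F B l
        fan2 i lt = fan-edge i lt , trans (kempe-outside H c W2.OnPath sy cl x _ x∉2) (fan-color i lt) ,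
                    kempe-missing H c W2.OnPath sy cl (F i) (B i) (subst (Missing H c (F i)) (sym (tzeq (W2.OnPath (F i)) refl)) (missing-spec (F i)))
          where
          tzeq : ∀ b → W2.OnPath (F i) ≡ b → swapABIf b (B i) ≡ B i
          tzeq false _ = refl
          tzeq true wi = swapABIf-other true (B i) nab
            where nab : ¬ IsAB (B i)
                  nab (inj₁ eq) = Bi-α i lt eq
                  nab (inj₂ eq) = true≢false (subst (λ k → W2.OnPath (F k) ≡ true) (Bi-β i lt eq) wi) j∉2
        mx2 : Missing H c' x α
        mx2 = kempe-missing H c W2.OnPath sy cl x α (subst (λ b → Missing H c x (swapABIf b α)) (sym x∉2) mα)
        mF2 : Missing H c' (F l) α
        mF2 = kempe-missing H c W2.OnPath sy cl (F l) α (subst (λ b → Missing H c (F l) (swapABIf b α)) (sym W2.OnPath-start) (subst (Missing H c (F l)) (sym swapABIf-α) ml))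

      extend : Σ Coloring (λ c' → Proper (addEdge H x y0) c')
      extend with WX.OnPath (F j') in eq
      ... | true = path-reaches-Fj′ eq
      ... | false = path-avoids-Fj′ eq

    extend-coloring : Σ Coloring (λ c' → Proper (addEdge H x y0) c')
    extend-coloring with missing? H c x (B l)
    ... | yes mB = rotate-fan l H c x F B (B l) sy ir pr hx0 fan≢x fan-injective (fan-prefix l (λ i lt → lt)) mB (missing-spec (F l))
    ... | no nmB with follow-spec H c x (B l) (¬missing⇒present {H} {c} {x} {B l} nmB) | stops-at-l
    ... | _ | inj₁ mB = ⊥-elim (nmB mB)
    ... | hxl , cxl | inj₂ (zero , _ , e) = ⊥-elim (true≢false (subst (λ v → H x v ≡ true) e hxl) hx0)
    ... | hxl , cxl | inj₂ (suc j' , le , e) = RepeatedColor.extend j' (s≤s⁻¹ le) hxl cxl e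

module Vizing {n : ℕ} (G : Graph n) (k : ℕ) (degree≤k : ∀ v → degree G v ≤ k) where
  open Colorings G (suc k)
  open AlternatingPaths G (suc k)

  A : Adj
  A = adj G

  missing-color : ∀ (H : Adj) (c : Coloring) → Proper H c → H ⊑ A → ∀ z → ∃ λ γ → Missing H c z γ
  missing-color H c pr sub z with any? (λ γ → missing? H c z γ)
  ... | yes p = p
  ... | no np = ⊥-elim (<-irrefl refl (begin-strict
      k                <⟨ count≥-surjective (H z) (col c z) allAct ⟩
      count (H z)      ≤⟨ sum-mono-≤ (λ y → ⟦⟧-mono (sub z y)) ⟩
      count (A z)      ≡⟨ sym (degree≡sum G z) ⟩
      degree G z       ≤⟨ degree≤k z ⟩
      k                ∎))
    where
    open ≤-Reasoning
    allAct : ∀ γ → ∃ λ y → H z y ≡ true × col c z y ≡ γ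
    allAct γ = ¬missing⇒present {H} {c} {z} {γ} (λ mm → np (γ , mm))

  inList : List (Fin n × Fin n) → Fin n → Fin n → Bool
  inList [] p q = false
  inList ((a , b) ∷ L) p q = sameEdgeᵇ a b p q ∨ inList L p q

  restrictTo : List (Fin n × Fin n) → Adj
  restrictTo L p q = A p q ∧ inList L p q

  inList-sym : ∀ L p q → inList L p q ≡ inList L q p
  inList-sym [] p q = refl
  inList-sym ((a , b) ∷ L) p q = cong₂ _∨_ (sameEdgeᵇ-sym a b p q) (inList-sym L p q)

  restrictTo-sym : ∀ L → SymmetricAdj (restrictTo L)
  restrictTo-sym L p q = cong₂ _∧_ (sym-adj p q) (inList-sym L p q)
    where sym-adj = Graph.sym G

  restrictTo-irrefl : ∀ L → IrreflexiveAdj (restrictTo L)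
  restrictTo-irrefl L p rewrite irrefl G p = refl

  restrictTo-⊑ : ∀ L → restrictTo L ⊑ A
  restrictTo-⊑ L p q e = proj₁ (∧-true⁻ e)

  SameEdge-adj : ∀ {a b p q} → SameEdge a b p q → A p q ≡ A a b
  SameEdge-adj (inj₁ (refl , refl)) = refl
  SameEdge-adj {a} {b} (inj₂ (refl , refl)) = Graph.sym G b a

  color-edges : ∀ L → Σ Coloring (λ c → Proper (restrictTo L) c)
  color-edges [] = record { col = λ _ _ → zero ; colSym = λ _ _ → refl } ,
              λ z a b h1 _ _ → ⊥-elim (true≢false (trans (sym (∧-zeroʳ (A z a))) h1) refl)
  color-edges ((a , b) ∷ L) with color-edges L
  ... | c , pr = add-pair (A a b) refl (H a b) refl
    where
    H = restrictTo L
    sub1 : restrictTo ((a , b) ∷ L) ⊑ addEdge H a b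
    sub1 p q e with ∧-true⁻ {A p q} e
    ... | ap , r with ∨-true⁻ {sameEdgeᵇ a b p q} r
    ... | inj₁ ip = addEdge-new {H} {a} {b} (sameEdgeᵇ-true⁻ ip)
    ... | inj₂ il = addEdge-old {H} {a} {b} (∧-true⁺ ap il)
    add-pair : ∀ x → A a b ≡ x → ∀ y → H a b ≡ y → Σ Coloring (λ c → Proper (restrictTo ((a , b) ∷ L)) c)
    add-pair false aab _ _ = c , proper-mono {restrictTo ((a , b) ∷ L)} {H} {c} s2 pr
      where s2 : restrictTo ((a , b) ∷ L) ⊑ H
            s2 p q e with addEdge-true⁻ {H} {a} {b} (sub1 p q e)
            ... | inj₁ h = h
            ... | inj₂ pp = ⊥-elim (true≢false (trans (sym (SameEdge-adj pp)) (proj₁ (∧-true⁻ {A p q} e))) aab)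
    add-pair true aab true hab = c , proper-mono {restrictTo ((a , b) ∷ L)} {H} {c} s2 pr
      where s2 : restrictTo ((a , b) ∷ L) ⊑ H
            s2 p q e with addEdge-true⁻ {H} {a} {b} (sub1 p q e)
            ... | inj₁ h = h
            ... | inj₂ (inj₁ (refl , refl)) = hab
            ... | inj₂ (inj₂ (refl , refl)) = trans (restrictTo-sym L b a) hab
    add-pair true aab false hab with VizingStep.extend-coloring G (suc k) H c (restrictTo-sym L) (restrictTo-irrefl L) pr
                                 (λ z → proj₁ (missing-color H c pr (restrictTo-⊑ L) z)) (λ z → proj₂ (missing-color H c pr (restrictTo-⊑ L) z))
                                 a b hab (λ e → true≢false aab (trans (cong (λ v → A a v) (sym e)) (irrefl G a)))
    ... | c' , pr' = c' , proper-mono {restrictTo ((a , b) ∷ L)} {addEdge H a b} {c'} sub1 pr'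

  allPairs : List (Fin n × Fin n)
  allPairs = cartesianProduct (allFin n) (allFin n)

  inList-∈ : ∀ {L p q} → (p , q) ∈ L → inList L p q ≡ true
  inList-∈ {(a , b) ∷ L} (here refl) = ∨-trueˡ (inList L a b) (sameEdgeᵇ-true (inj₁ (refl , refl)))
  inList-∈ {(a , b) ∷ L} {p} {q} (there m) = ∨-trueʳ (sameEdgeᵇ a b p q) (inList-∈ m)

  vizing : Σ Coloring (λ c → Proper A c)
  vizing with color-edges allPairs
  ... | c , pr = c , proper-mono {A} {restrictTo allPairs} {c} (λ p q e → ∧-true⁺ e (inList-∈ (∈-cartesianProduct⁺ (∈-allFin p) (∈-allFin q)))) pr

-- Stars as rainbow cuts

star : ∀ {n} (G : Graph n) → Fin n → EdgeSet G
star G u = record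
  { mem    = λ a b → adj G a b ∧ (⁅ u ⁆ a ∨ ⁅ u ⁆ b)
  ; memSym = λ a b → cong₂ _∧_ (Graph.sym G a b) (∨-comm (⁅ u ⁆ a) (⁅ u ⁆ b))
  ; memSub = λ a b e → proj₁ (∧-true⁻ {adj G a b} e)
  }

star-mem⁻ : ∀ {n} (G : Graph n) {u a b} → mem (star G u) a b ≡ true → adj G a b ≡ true × (a ≡ u ⊎ b ≡ u)
star-mem⁻ G {u} {a} {b} e with ∧-true⁻ {adj G a b} e
... | Aab , at-u with ∨-true⁻ {⁅ u ⁆ a} at-u
... | inj₁ a≡u = Aab , inj₁ (⁅⁆-true⁻ a≡u)
... | inj₂ b≡u = Aab , inj₂ (⁅⁆-true⁻ {v = u} {b} b≡u)

star-rainbow : ∀ {n m} {G : Graph n} (c : EdgeColoring G m) → Proper (adj G) c → ∀ u → Rainbow c (star G u)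
star-rainbow {G = G} c proper u a b x y ab∈R xy∈R same-col with star-mem⁻ G ab∈R | star-mem⁻ G xy∈R
... | Aub , inj₁ refl | Auy , inj₁ refl = inj₁ (refl , proper u b y Aub Auy same-col)
... | Aub , inj₁ refl | Axu , inj₂ refl = inj₂ (refl , proper u b x Aub (trans (Graph.sym G u x) Axu) (trans same-col (colSym c x u)))
... | Aau , inj₂ refl | Auy , inj₁ refl = inj₂ (proper u a y (trans (Graph.sym G u a) Aau) Auy (trans (colSym c u a) same-col) , refl)
... | Aau , inj₂ refl | Axu , inj₂ refl =
  inj₁ (proper u a x (trans (Graph.sym G u a) Aau) (trans (Graph.sym G u x) Axu) (trans (colSym c u a) (trans same-col (colSym c x u))) , refl)

star-separates : ∀ {n} (G : Graph n) {u v} → u ≢ v → ¬ Reach (removeEdges G (star G u)) u v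
star-separates G u≢v here = u≢v refl
star-separates G {u} u≢v (step {w = w} e _) with ∧-true⁻ {adj G u w} e
... | Auw , u∉star rewrite Auw | ⁅⁆-self u = true≢false u∉star refl

proper⇒rainbowDisconnected : ∀ {n m} {G : Graph n} (c : EdgeColoring G m) → Proper (adj G) c → RainbowDisconnected c
proper⇒rainbowDisconnected {G = G} c proper u v u≢v = star G u , star-rainbow c proper u , star-separates G u≢v

rd-upper-bound : ∀ {n} (G : Graph n) k → (∀ v → degree G v ≤ k) → RDColorable G (suc k)
rd-upper-bound G k degree≤k = let c , proper = Vizing.vizing G k degree≤k in c , proper⇒rainbowDisconnected c proper

-- Maximum adjacency orderings and pendant pairs

Crossing : ∀ {n} → Graph n → (Fin n → Bool) → Fin n → Fin n → Bool
Crossing G C x y = adj G x y ∧ (C x ∧ not (C y))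

crossing : ∀ {n} → Graph n → (Fin n → Bool) → ℕ
crossing G C = sum (λ x → count (Crossing G C x))

module MaximumAdjacency {n : ℕ} (G : Graph n) where

  A = adj G

  attachment : (Fin n → Bool) → Fin n → ℕ
  attachment S z = count (λ x → S x ∧ A x z)

  module _ (C : Fin n → Bool) where

    crossingWithin : (Fin n → Bool) → ℕ
    crossingWithin B = sum λ x → count λ y → B x ∧ (B y ∧ Crossing G C x y)

    crossingEdge-mono : ∀ {B B′ : Fin n → Bool} → (∀ x → B x ≡ true → B′ x ≡ true) → ∀ x y →
      ⟦ B x ∧ (B y ∧ Crossing G C x y) ⟧ ≤ ⟦ B′ x ∧ (B′ y ∧ Crossing G C x y) ⟧
    crossingEdge-mono {B} B⊆B′ x y = ⟦⟧-mono λ e →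
      let Bx , rest = ∧-true⁻ {B x} e; By , cr = ∧-true⁻ {B y} rest in ∧-true⁺ (B⊆B′ x Bx) (∧-true⁺ (B⊆B′ y By) cr)

    crossingWithin-mono : ∀ {B B′ : Fin n → Bool} → (∀ x → B x ≡ true → B′ x ≡ true) → crossingWithin B ≤ crossingWithin B′
    crossingWithin-mono {B} {B′} B⊆B′ = sum-mono-≤ λ x → sum-mono-≤ λ y → crossingEdge-mono {B} {B′} B⊆B′ x y

    crossingWithin≤crossing : ∀ B → crossingWithin B ≤ crossing G C
    crossingWithin≤crossing B = sum-mono-≤ λ x → sum-mono-≤ λ y → ⟦⟧-mono λ e → proj₂ (∧-true⁻ {B y} (proj₂ (∧-true⁻ {B x} e)))

    crossingWithin-new-edge : ∀ {B B′ : Fin n → Bool} → (∀ x → B x ≡ true → B′ x ≡ true) → ∀ a b → B′ a ≡ true → B′ b ≡ true →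
      A a b ≡ true → C a ≡ true → C b ≡ false → B a ≡ false ⊎ B b ≡ false → crossingWithin B < crossingWithin B′
    crossingWithin-new-edge {B} {B′} B⊆B′ a b B′a B′b Aab Ca Cb a∉B⊎b∉B =
      sum-strictly-mono _ _ a (λ x → sum-mono-≤ (crossingEdge-mono {B} {B′} B⊆B′ x))
        (sum-strictly-mono _ _ b (crossingEdge-mono {B} {B′} B⊆B′ a) (lost a∉B⊎b∉B))
      where
      lost : B a ≡ false ⊎ B b ≡ false → ⟦ B a ∧ (B b ∧ Crossing G C a b) ⟧ < ⟦ B′ a ∧ (B′ b ∧ Crossing G C a b) ⟧
      lost (inj₁ a∉B) rewrite a∉B | B′a | B′b | Aab | Ca | Cb = ≤-refl
      lost (inj₂ b∉B) rewrite b∉B | ∧-zeroʳ (B a) | B′a | B′b | Aab | Ca | Cb = ≤-refl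

    crossingWithin-grow : ∀ {B B′ : Fin n → Bool} → (∀ x → B x ≡ true → B′ x ≡ true) → ∀ v z → B′ v ≡ true → B′ z ≡ true →
      C v ≢ C z → B v ≡ false ⊎ B z ≡ false → crossingWithin B + ⟦ A v z ⟧ ≤ crossingWithin B′
    crossingWithin-grow {B} {B′} B⊆B′ v z B′v B′z Cv≢Cz v∉B⊎z∉B with A v z in Avz
    ... | false = subst (_≤ crossingWithin B′) (sym (+-identityʳ _)) (crossingWithin-mono B⊆B′)
    ... | true with C v in Cv | C z in Cz
    ... | true  | true  = ⊥-elim (Cv≢Cz refl)
    ... | false | false = ⊥-elim (Cv≢Cz refl)
    ... | true  | false = subst (_≤ crossingWithin B′) (+-comm 1 _)
                            (crossingWithin-new-edge B⊆B′ v z B′v B′z Avz Cv Cz v∉B⊎z∉B)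
    ... | false | true  = subst (_≤ crossingWithin B′) (+-comm 1 _)
                            (crossingWithin-new-edge B⊆B′ z v B′z B′v (trans (Graph.sym G z v) Avz) Cz Cv (swap v∉B⊎z∉B))

  ∅ : Fin n → Bool
  ∅ _ = false

  data MAOrder : (Fin n → Bool) → Fin n → Set where
    start  : ∀ p → MAOrder (insert p ∅) p
    extend : ∀ {S p v} → MAOrder S p → S v ≡ false → (∀ y → S y ≡ false → attachment S y ≤ attachment S v) →
             MAOrder (insert v S) v

  MAOrder-last : ∀ {S p} → MAOrder S p → S p ≡ true
  MAOrder-last (start p) = ⁅⁆-self p
  MAOrder-last (extend {S} {v = v} _ _ _) = insert-self v S

  attachment-insert : ∀ S v z → S v ≡ false → attachment (insert v S) z ≤ attachment S z + ⟦ A v z ⟧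
  attachment-insert S v z v∉S = begin
    attachment (insert v S) z                                 ≡⟨ sym (+-identityʳ _) ⟩
    attachment (insert v S) z + 0                             ≡⟨ cong (λ b → attachment (insert v S) z + ⟦ b ∧ A v z ⟧) (sym v∉S) ⟩
    attachment (insert v S) z + ⟦ S v ∧ A v z ⟧               ≤⟨ sum-mono-≤-except _ _ v (λ x x≢v → ⟦⟧-mono (subst (λ b → b ∧ A x z ≡ true) (insert-other S x≢v))) ⟩
    attachment S z + ⟦ insert v S v ∧ A v z ⟧                 ≡⟨ cong (λ b → attachment S z + ⟦ b ∧ A v z ⟧) (insert-self v S) ⟩
    attachment S z + ⟦ A v z ⟧                                ∎
    where open ≤-Reasoning

  attachment≤crossingWithin : ∀ C {S p} → MAOrder S p → ∀ z → S z ≡ false → C z ≢ C p →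
    attachment S z ≤ crossingWithin C (insert z S)
  attachment≤crossingWithin C (start p) z z∉S Cz≢Cp = begin
    attachment (insert p ∅) z                  ≤⟨ attachment-insert ∅ p z refl ⟩
    attachment ∅ z + ⟦ A p z ⟧                 ≡⟨ cong (_+ ⟦ A p z ⟧) (trans (sum-zero {n} _ (λ _ → refl)) (sym (sum-zero {n} _ (λ _ → sum-zero {n} _ (λ _ → refl))))) ⟩
    crossingWithin C ∅ + ⟦ A p z ⟧             ≤⟨ crossingWithin-grow C {∅} {insert z (insert p ∅)} (λ _ ()) p z (insert-⊇ z (insert p ∅) {p} (insert-self p ∅)) (insert-self z (insert p ∅)) (λ e → Cz≢Cp (sym e)) (inj₁ refl) ⟩
    crossingWithin C (insert z (insert p ∅))   ∎
    where open ≤-Reasoning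
  attachment≤crossingWithin C (extend {S} {p} {v} ord v∉S max) z z∉S′ Cz≢Cv with C v ≟B C p
  ... | yes Cv≡Cp = begin
    attachment (insert v S) z                    ≤⟨ attachment-insert S v z v∉S ⟩
    attachment S z + ⟦ A v z ⟧                   ≤⟨ +-monoˡ-≤ _ (attachment≤crossingWithin C ord z z∉S (λ e → Cz≢Cv (trans e (sym Cv≡Cp)))) ⟩
    crossingWithin C (insert z S) + ⟦ A v z ⟧    ≤⟨ crossingWithin-grow C {insert z S} {insert z (insert v S)} S+z⊆ v z (insert-⊇ z (insert v S) {v} (insert-self v S)) (insert-self z (insert v S)) (λ e → Cz≢Cv (sym e)) (inj₁ (trans (insert-other S (λ e → z≢v (sym e))) v∉S)) ⟩
    crossingWithin C (insert z (insert v S))     ∎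
    where
    open ≤-Reasoning
    z≢v : z ≢ v
    z≢v e = true≢false (trans (cong (insert v S) e) (insert-self v S)) z∉S′
    z∉S : S z ≡ false
    z∉S = insert-false⁻ S z∉S′
    S+z⊆ : ∀ x → insert z S x ≡ true → insert z (insert v S) x ≡ true
    S+z⊆ x e with ∨-true⁻ {S x} e
    ... | inj₁ x∈S = insert-⊇ z (insert v S) (insert-⊇ v S x∈S)
    ... | inj₂ x≡z rewrite ⁅⁆-true⁻ {v = z} {x} x≡z = insert-self z (insert v S)
  ... | no Cv≢Cp = begin
    attachment (insert v S) z                    ≤⟨ attachment-insert S v z v∉S ⟩
    attachment S z + ⟦ A v z ⟧                   ≤⟨ +-monoˡ-≤ _ (≤-trans (max z z∉S) (attachment≤crossingWithin C ord v v∉S Cv≢Cp)) ⟩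
    crossingWithin C (insert v S) + ⟦ A v z ⟧    ≤⟨ crossingWithin-grow C {insert v S} {insert z (insert v S)} (λ x → insert-⊇ z (insert v S)) v z (insert-⊇ z (insert v S) {v} (insert-self v S)) (insert-self z (insert v S)) (λ e → Cz≢Cv (sym e)) (inj₂ z∉S′) ⟩
    crossingWithin C (insert z (insert v S))     ∎
    where
    open ≤-Reasoning
    z∉S : S z ≡ false
    z∉S = insert-false⁻ S z∉S′

  outside : (Fin n → Bool) → ℕ
  outside S = count (λ x → not (S x))

  outside-insert : ∀ S v → S v ≡ false → suc (outside (insert v S)) ≡ outside S
  outside-insert S v v∉S = ≤-antisym
    (subst₂ _≤_ (trans (cong (sum f +_) gv) (+-comm _ 1)) (trans (cong (sum g +_) fv) (+-identityʳ _))
      (sum-mono-≤-except f g v (λ x x≢v → ≤-reflexive (agree x x≢v))))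
    (subst₂ _≤_ (trans (cong (sum g +_) fv) (+-identityʳ _)) (trans (cong (sum f +_) gv) (+-comm _ 1))
      (sum-mono-≤-except g f v (λ x x≢v → ≤-reflexive (sym (agree x x≢v)))))
    where
    f = λ x → ⟦ not (insert v S x) ⟧
    g = λ x → ⟦ not (S x) ⟧
    fv : f v ≡ 0
    fv rewrite insert-self v S = refl
    gv : g v ≡ 1
    gv rewrite v∉S = refl
    agree : ∀ x → x ≢ v → f x ≡ g x
    agree x x≢v = cong (λ b → ⟦ not b ⟧) (insert-other S x≢v)

  CompleteMAOrder : Set
  CompleteMAOrder = Σ (Fin n → Bool) λ S → Σ (Fin n) λ s → Σ (Fin n) λ t →
    MAOrder S s × S t ≡ false × (∀ y → y ≢ t → S y ≡ true)

  complete-MAOrder : ∀ r {S p} → MAOrder S p → outside S ≡ suc r → CompleteMAOrder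
  complete-MAOrder zero {S} {p} ord one-left with sum-positive⁻ _ (≤-reflexive (sym one-left))
  ... | t , t∉S = S , p , t , ord , not-true⁻ (⟦⟧-positive⁻ t∉S) , others
    where
    others : ∀ y → y ≢ t → S y ≡ true
    others y y≢t = ¬false⇒true λ y∉S → <-irrefl refl (begin-strict
      1                               ≡⟨ sym (sum-δ t) ⟩
      sum (δ t)                       <⟨ sum-strictly-mono (δ t) _ y (δt≤ t∉S) (δt< y∉S) ⟩
      outside S                       ≡⟨ one-left ⟩
      1                               ∎)
      where
      open ≤-Reasoning
      δt≤ : 1 ≤ ⟦ not (S t) ⟧ → ∀ x → δ t x ≤ ⟦ not (S x) ⟧
      δt≤ t∉S x with x ≟F t
      ... | yes refl = t∉S
      ... | no _ = z≤n
      δt< : S y ≡ false → δ t y < ⟦ not (S y) ⟧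
      δt< y∉S rewrite dec-false (y ≟F t) y≢t | y∉S = ≤-refl
  complete-MAOrder (suc r) {S} ord more-left
    with argmax (λ y → not (S y)) (attachment S) (map₂ ⟦⟧-positive⁻ (sum-positive⁻ _ (subst (1 ≤_) (sym more-left) (s≤s z≤n))))
  ... | v , v∉S , max = complete-MAOrder r (extend ord (not-true⁻ v∉S) (λ y y∉S → max y (not-true⁺ y∉S)))
                          (ℕ-suc-injective (trans (outside-insert S v (not-true⁻ v∉S)) more-left))

pendant-pair : ∀ {n} (G : Graph n) → 2 ≤ n →
  Σ (Fin n) λ s → Σ (Fin n) λ t → s ≢ t × (∀ C → C s ≡ true → C t ≡ false → degree G t ≤ crossing G C)
pendant-pair {suc zero} G (s≤s ())
pendant-pair {suc (suc r)} G _ with complete-MAOrder r (start zero) (ℕ-suc-injective (trans (outside-insert ∅ zero refl) (sum-const-1 _)))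
  where open MaximumAdjacency G
... | S , s , t , ord , t∉S , others = s , t , s≢t , λ C Cs Ct → begin
    degree G t                               ≡⟨ degree≡attachment ⟩
    attachment S t                           ≤⟨ attachment≤crossingWithin C ord t t∉S (λ e → true≢false (trans e Cs) Ct) ⟩
    crossingWithin C (insert t S)            ≤⟨ crossingWithin≤crossing C (insert t S) ⟩
    crossing G C                             ∎
  where
  open MaximumAdjacency G
  open ≤-Reasoning
  s≢t : s ≢ t
  s≢t e = true≢false (subst (λ v → S v ≡ true) e (MAOrder-last ord)) t∉S
  degree≡attachment : degree G t ≡ attachment S t
  degree≡attachment = trans (degree≡sum G t) (sum-cong-≗ edge-to-t)
    where
    edge-to-t : ∀ x → ⟦ adj G t x ⟧ ≡ ⟦ S x ∧ adj G x t ⟧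
    edge-to-t x with x ≟F t
    ... | yes refl rewrite t∉S | irrefl G x = refl
    ... | no x≢t rewrite others x x≢t | Graph.sym G x t = refl

reachable-side : ∀ {n} (G : Graph n) (R : EdgeSet G) s t → ¬ Reach (removeEdges G R) s t →
  ¬ ¬ (Σ (Fin n → Bool) λ C → C s ≡ true × C t ≡ false × (∀ x y → Crossing G C x y ≡ true → mem R x y ≡ true))
reachable-side G R s t ¬reach k = dn-dec (Reach (removeEdges G R) s) λ reach? →
  k ((λ x → does (reach? x)) , dec-true (reach? s) here , dec-false (reach? t) ¬reach , crossing⊆R reach?)
  where
  crossing⊆R : (reach? : ∀ x → Dec (Reach (removeEdges G R) s x)) → ∀ x y →
    Crossing G (λ z → does (reach? z)) x y ≡ true → mem R x y ≡ true
  crossing⊆R reach? x y cr with ∧-true⁻ {adj G x y} cr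
  ... | Axy , rest with ∧-true⁻ {does (reach? x)} rest
  ... | x-reached , y-unreached with mem R x y in x-y∈R
  ... | true = refl
  ... | false = ⊥-elim (true≢false (dec-true (reach? y) (Reach-snoc (does-true⁻ (reach? x) x-reached) survives)) (not-true⁻ y-unreached))
    where
    survives : removeEdges G R x y ≡ true
    survives rewrite Axy | x-y∈R = refl

crossing≤colors : ∀ {n m} {G : Graph n} (c : EdgeColoring G m) (R : EdgeSet G) → Rainbow c R → (C : Fin n → Bool) →
  (∀ x y → Crossing G C x y ≡ true → mem R x y ≡ true) → crossing G C ≤ m
crossing≤colors {G = G} c R rainbow C crossing⊆R = count₂≤-injective (Crossing G C) (col c) distinct
  where
  sides : ∀ {x y} → Crossing G C x y ≡ true → C x ≡ true × C y ≡ false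
  sides {x} {y} cr = let _ , rest = ∧-true⁻ {adj G x y} cr; Cx , ¬Cy = ∧-true⁻ {C x} rest in Cx , not-true⁻ ¬Cy
  distinct : ∀ x y x′ y′ → Crossing G C x y ≡ true → Crossing G C x′ y′ ≡ true → col c x y ≡ col c x′ y′ → x ≡ x′ × y ≡ y′
  distinct x y x′ y′ p q e with rainbow x y x′ y′ (crossing⊆R x y p) (crossing⊆R x′ y′ q) e
  ... | inj₁ same = same
  ... | inj₂ (x≡y′ , _) = ⊥-elim (true≢false (trans (cong C (sym x≡y′)) (proj₁ (sides p))) (proj₂ (sides q)))

two-vertices : ∀ {n} (G : Graph n) k → 1 ≤ n → 1 ≤ k → (∀ v → k ≤ degree G v) → 2 ≤ n
two-vertices {zero} _ _ () _ _
two-vertices {suc zero} G k _ 1≤k k≤degree with ≤-trans 1≤k (≤-trans (k≤degree zero) (≤-reflexive degree≡0))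
  where
  degree≡0 : degree G zero ≡ 0
  degree≡0 = trans (degree≡sum G zero) (cong (λ b → ⟦ b ⟧ + 0) (irrefl G zero))
... | ()
two-vertices {suc (suc _)} _ _ _ _ _ = s≤s (s≤s z≤n)

rd-lower-bound : ∀ {n} (G : Graph n) k → 2 ≤ n → (∀ v → k ≤ degree G v) → ∀ m → RDColorable G m → k ≤ m
rd-lower-bound G k 2≤n k≤degree m (c , rd) with pendant-pair G 2≤n
... | s , t , s≢t , degree≤crossing with rd s t s≢t
... | R , rainbow , ¬reach = decidable-stable (k ≤? m) λ k≰m →
  reachable-side G R s t ¬reach λ (C , Cs , Ct , crossing⊆R) → k≰m (begin
    k             ≤⟨ k≤degree t ⟩
    degree G t    ≤⟨ degree≤crossing C Cs Ct ⟩
    crossing G C  ≤⟨ crossing≤colors c R rainbow C crossing⊆R ⟩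
    m             ∎)
  where open ≤-Reasoning

lemma14 : ∀ {n : ℕ} (G : Graph n) (k : ℕ) → 1 ≤ n → 1 ≤ k →
    Connected G → Regular k G →
    RDColorable G (k + 1) × (∀ m → RDColorable G m → k ≤ m)
lemma14 G k 1≤n 1≤k _ reg =
  subst (RDColorable G) (+-comm 1 k) (rd-upper-bound G k (λ v → ≤-reflexive (reg v))) ,
  rd-lower-bound G k (two-vertices G k 1≤n 1≤k k≤degree) k≤degree
  where
  k≤degree : ∀ v → k ≤ degree G v
  k≤degree v = ≤-reflexive (sym (reg v))
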